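{- Let $v\ge0$, let $\varsigma\in\mathcal{S}_p(v,0)$ be a prime substitution, and let $d\ge0$. Then: (a) the map $\mu\mapsto\mu\circ\varsigma$ is a bijection of the set of level-$d$ minterms of $\mathbf{K}[v,d]$ onto itself (in particular $\mu\circ\varsigma$ is again a minterm); (b) the map $\varphi\mapsto\varphi\circ\varsigma$ is a lattice automorphism of $\mathbf{K}[v,d]$.
   Context: Formulas are unimodal propositional formulas in variables $p_0,\dots,p_{v-1}$; $\mathbf{K}$ is the least normal modal logic. $\mathbf{K}[v,d]$ is the Lindenbaum–Tarski algebra of formulas in $p_0,\dots,p_{v-1}$ of modal degree $\le d$ modulo $\mathbf{K}$-equivalence; it is a finite Boolean algebra whose atoms (minterms) are: level 0: the $2^v$ conjunctions $\bigwedge_i\pm p_i$; level $d+1$: all $m\wedge\bigwedge_\mu\pm\Diamond\mu$ with $m$ a level-0 minterm and $\mu$ ranging over all level-$d$ minterms (all sign choices). A level-0 substitution is a tuple $\sigma=(\sigma_0,\dots,\sigma_{v-1})$ of classical propositional formulas (up to equivalence) in $p_0,\dots,p_{v-1}$, acting by $\varphi\circ\sigma=\varphi(\sigma_0,\dots,\sigma_{v-1})$ (well defined on $\mathbf{K}$-classes); composition $(\sigma\sigma')_i=\sigma_i(\sigma'_0,\dots,\sigma'_{v-1})$ makes these a monoid with identity $(p_0,\dots,p_{v-1})$, and the prime substitutions are its invertible elements, forming the group $\mathcal{S}_p(v,0)$. -}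

module Defs where

open import Data.Bool using (Bool; true; false; not; _∧_; _∨_; if_then_else_)
open import Data.Nat using (ℕ; zero; suc; _⊔_; _≤_; z≤n)
open import Data.Fin using (Fin)
open import Data.List using (List; []; _∷_; map; concatMap; allFin)
open import Data.List.Membership.Propositional using (_∈_)
open import Data.Product using (Σ; _×_; _,_; proj₁; proj₂; ∃)
open import Relation.Binary.PropositionalEquality using (_≡_; refl; cong; cong₂)
open import Algebra.Lattice.Bundles using (RawLattice)
open import Algebra.Lattice.Morphism.Structures using (module LatticeMorphisms)
open import Function.Definitions using (Bijective)

infixr 6 _∧′_
infixr 5 _∨′_
infixr 4 _⇒_

data Form (v : ℕ) : Set where
  var  : Fin v → Form v
  ⊥′   : Form v
  ⊤′   : Form v
  ¬′_  : Form v → Form v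
  _∧′_ : Form v → Form v → Form v
  _∨′_ : Form v → Form v → Form v
  _⇒_  : Form v → Form v → Form v
  □_   : Form v → Form v

◇_ : ∀ {v} → Form v → Form v
◇ φ = ¬′ (□ (¬′ φ))

_⇔_ : ∀ {v} → Form v → Form v → Form v
φ ⇔ ψ = (φ ⇒ ψ) ∧′ (ψ ⇒ φ)

md : ∀ {v} → Form v → ℕ
md (var i)   = 0
md ⊥′        = 0
md ⊤′        = 0
md (¬′ φ)    = md φ
md (φ ∧′ ψ)  = md φ ⊔ md ψ
md (φ ∨′ ψ)  = md φ ⊔ md ψ
md (φ ⇒ ψ)   = md φ ⊔ md ψ
md (□ φ)     = suc (md φ)

-- The logic K: all substitution instances of classical tautologies
-- (boxed subformulas treated as propositional atoms), the K axiom,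
-- modus ponens and necessitation.

evalB : ∀ {v} → (Fin v → Bool) → (Form v → Bool) → Form v → Bool
evalB ρ β (var i)  = ρ i
evalB ρ β ⊥′       = false
evalB ρ β ⊤′       = true
evalB ρ β (¬′ φ)   = not (evalB ρ β φ)
evalB ρ β (φ ∧′ ψ) = evalB ρ β φ ∧ evalB ρ β ψ
evalB ρ β (φ ∨′ ψ) = evalB ρ β φ ∨ evalB ρ β ψ
evalB ρ β (φ ⇒ ψ)  = not (evalB ρ β φ) ∨ evalB ρ β ψ
evalB ρ β (□ φ)    = β φ

data ⊢K_ {v : ℕ} : Form v → Set where
  taut : ∀ {φ} → (∀ ρ β → evalB ρ β φ ≡ true) → ⊢K φ
  axK  : ∀ {φ ψ} → ⊢K (□ (φ ⇒ ψ) ⇒ (□ φ ⇒ □ ψ))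
  mp   : ∀ {φ ψ} → ⊢K (φ ⇒ ψ) → ⊢K φ → ⊢K ψ
  nec  : ∀ {φ} → ⊢K φ → ⊢K (□ φ)

infix 3 _≈K_
_≈K_ : ∀ {v} → Form v → Form v → Set
φ ≈K ψ = ⊢K (φ ⇔ ψ)

KCarrier : ℕ → ℕ → Set
KCarrier v d = Σ (Form v) (λ φ → md φ ≤ d)

_≈[K]_ : ∀ {v d} → KCarrier v d → KCarrier v d → Set
x ≈[K] y = proj₁ x ≈K proj₁ y

m⊔n≤ : ∀ {m n d} → m ≤ d → n ≤ d → m ⊔ n ≤ d
m⊔n≤ {zero} {n} p q = q
m⊔n≤ {suc m} {zero} p q = p
m⊔n≤ {suc m} {suc n} (Data.Nat.s≤s p) (Data.Nat.s≤s q) = Data.Nat.s≤s (m⊔n≤ p q)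

K[_,_] : ℕ → ℕ → RawLattice _ _
K[ v , d ] = record
  { Carrier = KCarrier v d
  ; _≈_     = _≈[K]_
  ; _∧_     = λ x y → (proj₁ x ∧′ proj₁ y) , m⊔n≤ (proj₂ x) (proj₂ y)
  ; _∨_     = λ x y → (proj₁ x ∨′ proj₁ y) , m⊔n≤ (proj₂ x) (proj₂ y)
  }

signs : ∀ {v} → List (Form v) → List (Form v)
signs []       = ⊤′ ∷ []
signs (a ∷ as) = concatMap (λ c → (a ∧′ c) ∷ ((¬′ a) ∧′ c) ∷ []) (signs as)

minterms : (v d : ℕ) → List (Form v)
minterms v zero    = signs (map var (allFin v))
minterms v (suc d) =
  concatMap (λ m → map (λ c → m ∧′ c) (signs (map ◇_ (minterms v d))))
            (minterms v zero)

Minterm : (v d : ℕ) → Set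
Minterm v d = Σ (Form v) (λ μ → μ ∈ minterms v d)

_≈M_ : ∀ {v d} → Minterm v d → Minterm v d → Set
μ ≈M ν = proj₁ μ ≈K proj₁ ν

data PForm (v : ℕ) : Set where
  pvar : Fin v → PForm v
  p⊥ p⊤ : PForm v
  p¬ : PForm v → PForm v
  p∧ p∨ p⇒ : PForm v → PForm v → PForm v

evalP : ∀ {v} → (Fin v → Bool) → PForm v → Bool
evalP ρ (pvar i)  = ρ i
evalP ρ p⊥        = false
evalP ρ p⊤        = true
evalP ρ (p¬ a)    = not (evalP ρ a)
evalP ρ (p∧ a b)  = evalP ρ a ∧ evalP ρ b
evalP ρ (p∨ a b)  = evalP ρ a ∨ evalP ρ b
evalP ρ (p⇒ a b)  = not (evalP ρ a) ∨ evalP ρ b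

_≈P_ : ∀ {v} → PForm v → PForm v → Set
a ≈P b = ∀ ρ → evalP ρ a ≡ evalP ρ b

Subst0 : ℕ → Set
Subst0 v = Fin v → PForm v

psubst : ∀ {v} → Subst0 v → PForm v → PForm v
psubst σ (pvar i) = σ i
psubst σ p⊥       = p⊥
psubst σ p⊤       = p⊤
psubst σ (p¬ a)   = p¬ (psubst σ a)
psubst σ (p∧ a b) = p∧ (psubst σ a) (psubst σ b)
psubst σ (p∨ a b) = p∨ (psubst σ a) (psubst σ b)
psubst σ (p⇒ a b) = p⇒ (psubst σ a) (psubst σ b)

_·_ : ∀ {v} → Subst0 v → Subst0 v → Subst0 v
(σ · σ′) i = psubst σ′ (σ i)

idS : ∀ {v} → Subst0 v
idS = pvar

_≈S_ : ∀ {v} → Subst0 v → Subst0 v → Set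
σ ≈S τ = ∀ i → σ i ≈P τ i

IsPrime : ∀ {v} → Subst0 v → Set
IsPrime σ = Σ (Subst0 _) (λ τ → ((σ · τ) ≈S idS) × ((τ · σ) ≈S idS))

embed : ∀ {v} → PForm v → Form v
embed (pvar i) = var i
embed p⊥       = ⊥′
embed p⊤       = ⊤′
embed (p¬ a)   = ¬′ embed a
embed (p∧ a b) = embed a ∧′ embed b
embed (p∨ a b) = embed a ∨′ embed b
embed (p⇒ a b) = embed a ⇒ embed b

_∘S_ : ∀ {v} → Form v → Subst0 v → Form v
var i    ∘S σ = embed (σ i)
⊥′       ∘S σ = ⊥′
⊤′       ∘S σ = ⊤′
(¬′ φ)   ∘S σ = ¬′ (φ ∘S σ)
(φ ∧′ ψ) ∘S σ = (φ ∘S σ) ∧′ (ψ ∘S σ)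
(φ ∨′ ψ) ∘S σ = (φ ∘S σ) ∨′ (ψ ∘S σ)
(φ ⇒ ψ)  ∘S σ = (φ ∘S σ) ⇒ (ψ ∘S σ)
(□ φ)    ∘S σ = □ (φ ∘S σ)

md-embed : ∀ {v} (a : PForm v) → md (embed a) ≡ 0
md-embed (pvar i) = refl
md-embed p⊥ = refl
md-embed p⊤ = refl
md-embed (p¬ a) = md-embed a
md-embed (p∧ a b) = cong₂ _⊔_ (md-embed a) (md-embed b)
md-embed (p∨ a b) = cong₂ _⊔_ (md-embed a) (md-embed b)
md-embed (p⇒ a b) = cong₂ _⊔_ (md-embed a) (md-embed b)

md-∘S : ∀ {v} (φ : Form v) (σ : Subst0 v) → md (φ ∘S σ) ≡ md φ
md-∘S (var i) σ = md-embed (σ i)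
md-∘S ⊥′ σ = refl
md-∘S ⊤′ σ = refl
md-∘S (¬′ φ) σ = md-∘S φ σ
md-∘S (φ ∧′ ψ) σ = cong₂ _⊔_ (md-∘S φ σ) (md-∘S ψ σ)
md-∘S (φ ∨′ ψ) σ = cong₂ _⊔_ (md-∘S φ σ) (md-∘S ψ σ)
md-∘S (φ ⇒ ψ) σ = cong₂ _⊔_ (md-∘S φ σ) (md-∘S ψ σ)
md-∘S (□ φ) σ = cong suc (md-∘S φ σ)

≡-≤ : ∀ {a b c : ℕ} → a ≡ b → b ≤ c → a ≤ c
≡-≤ refl p = p

substK : ∀ {v d} → Subst0 v → KCarrier v d → KCarrier v d
substK σ (φ , p) = (φ ∘S σ) , ≡-≤ (md-∘S φ σ) p

IsLatticeAutomorphism : ∀ {v d} → (KCarrier v d → KCarrier v d) → Set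
IsLatticeAutomorphism {v} {d} f =
  LatticeMorphisms.IsLatticeIsomorphism K[ v , d ] K[ v , d ] f

{-# OPTIONS --safe #-}
module Submission where

-- A prime substitution ς with inverse τ acts on level-0 minterms by pulling back the
-- valuation a minterm describes along τ: a valuation ρ satisfies (minterm of r) ∘ ς iff
-- ρ ∘ ς = r iff ρ = r ∘ τ.  Since ∘ς commutes with ◇, it sends m ∧ ⋀_μ ±_μ ◇μ to
-- (m ∘ ς) ∧ ⋀_μ ±_μ ◇(μ ∘ ς), and if ∘ς permutes the level-d minterms (up to K) this is,
-- after reordering the conjuncts, the minterm m′ ∧ ⋀_ν ±_{π⁻¹ν} ◇ν.  So by induction on d
-- there is a permutation of the minterms realising ∘ς; ∘τ undoes it, which also makes
-- ∘ς a lattice automorphism of K[v,d].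

open import Defs
open import Data.Bool using (Bool; true; false; not; _∧_; _∨_)
open import Data.Bool.Properties using (∧-conicalˡ; ∧-conicalʳ; not-injective; ⇔→≡)
open import Data.Nat using (ℕ; zero; suc)
open import Data.Fin using (Fin)
open import Data.Product using (Σ; ∃; _×_; _,_; proj₁; proj₂; map₂)
open import Data.List using (List; []; _∷_; _++_; map; concatMap; allFin; cartesianProductWith)
open import Data.List.Relation.Unary.Any using (here; there)
open import Data.List.Relation.Unary.All using ([]; _∷_)
open import Data.List.Relation.Unary.AllPairs using ([]; _∷_)
open import Data.Empty using (⊥-elim)
open import Data.List.Membership.Propositional using (_∈_; find; lose)
open import Data.List.Membership.Propositional.Properties
  using (∈-concatMap⁺; ∈-concatMap⁻; ∈-allFin; ∈-cartesianProductWith⁺; ∈-cartesianProductWith⁻)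
open import Data.List.Membership.Propositional.Properties.WithK using (unique⇒irrelevant)
open import Data.List.Relation.Unary.Unique.Propositional using (Unique)
open import Data.List.Relation.Unary.Unique.Propositional.Properties
  using (allFin⁺; cartesianProductWith⁺)
open import Data.Product.Function.NonDependent.Propositional using (_×-↔_)
open import Function using (id; _∘_; mk⇔)
open import Function.Bundles using (_↔_; Inverse; mk↔ₛ′)
open import Function.Construct.Composition using (_↔-∘_)
open import Function.Construct.Symmetry using (↔-sym)
open import Function.Definitions using (Bijective)
open import Relation.Binary.Bundles using (Setoid)
open import Relation.Binary.Structures using (IsEquivalence)
open import Relation.Binary.PropositionalEquality
  using (_≡_; _≢_; _≗_; refl; sym; trans; cong; cong₂; subst)
open import Relation.Binary.PropositionalEquality.Properties
  using (subst-subst-sym; subst-sym-subst)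
import Relation.Binary.Reasoning.Setoid as SetoidReasoning

⇒-true : ∀ {a b : Bool} → (a ≡ true → b ≡ true) → not a ∨ b ≡ true
⇒-true {false} _ = refl
⇒-true {true}  f = f refl

⇔-true⁺ : ∀ {a b : Bool} → a ≡ b → (not a ∨ b) ∧ (not b ∨ a) ≡ true
⇔-true⁺ {false} refl = refl
⇔-true⁺ {true}  refl = refl

⇔-true⁻ : ∀ {a b : Bool} → (not a ∨ b) ∧ (not b ∨ a) ≡ true → a ≡ b
⇔-true⁻ {false} {false} _  = refl
⇔-true⁻ {false} {true}  ()
⇔-true⁻ {true}  {false} ()
⇔-true⁻ {true}  {true}  _  = refl

module _ {v : ℕ} where

  taut-mp₁ : {h φ : Form v} → (∀ ρ β → evalB ρ β h ≡ true → evalB ρ β φ ≡ true) →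
          ⊢K h → ⊢K φ
  taut-mp₁ k = mp (taut λ ρ β → ⇒-true (k ρ β))

  taut-mp₂ : {h₁ h₂ φ : Form v} →
          (∀ ρ β → evalB ρ β h₁ ≡ true → evalB ρ β h₂ ≡ true → evalB ρ β φ ≡ true) →
          ⊢K h₁ → ⊢K h₂ → ⊢K φ
  taut-mp₂ k p = mp (mp (taut λ ρ β → ⇒-true λ h₁ → ⇒-true (k ρ β h₁)) p)

  ≈K-taut : {φ ψ : Form v} → (∀ ρ β → evalB ρ β φ ≡ evalB ρ β ψ) → φ ≈K ψ
  ≈K-taut k = taut λ ρ β → ⇔-true⁺ (k ρ β)

  ≈K-lift₁ : {φ ψ φ′ ψ′ : Form v} →
             (∀ {ρ β} → evalB ρ β φ ≡ evalB ρ β ψ → evalB ρ β φ′ ≡ evalB ρ β ψ′) →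
             φ ≈K ψ → φ′ ≈K ψ′
  ≈K-lift₁ k = taut-mp₁ λ _ _ e → ⇔-true⁺ (k (⇔-true⁻ e))

  ≈K-lift₂ : {φ ψ φ′ ψ′ φ″ ψ″ : Form v} →
             (∀ {ρ β} → evalB ρ β φ ≡ evalB ρ β ψ → evalB ρ β φ′ ≡ evalB ρ β ψ′ →
                        evalB ρ β φ″ ≡ evalB ρ β ψ″) →
             φ ≈K ψ → φ′ ≈K ψ′ → φ″ ≈K ψ″
  ≈K-lift₂ k = taut-mp₂ λ _ _ e e′ → ⇔-true⁺ (k (⇔-true⁻ e) (⇔-true⁻ e′))

  ≈K-refl : {φ : Form v} → φ ≈K φ
  ≈K-refl = ≈K-taut λ _ _ → refl

  ≈K-reflexive : {φ ψ : Form v} → φ ≡ ψ → φ ≈K ψ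
  ≈K-reflexive refl = ≈K-refl

  ≈K-sym : {φ ψ : Form v} → φ ≈K ψ → ψ ≈K φ
  ≈K-sym = ≈K-lift₁ sym

  ≈K-trans : {φ ψ χ : Form v} → φ ≈K ψ → ψ ≈K χ → φ ≈K χ
  ≈K-trans = ≈K-lift₂ trans

  ≈K-isEquivalence : IsEquivalence (_≈K_ {v})
  ≈K-isEquivalence = record { refl = ≈K-refl ; sym = ≈K-sym ; trans = ≈K-trans }

  ¬-cong : {φ ψ : Form v} → φ ≈K ψ → ¬′ φ ≈K ¬′ ψ
  ¬-cong = ≈K-lift₁ (cong not)

  ∧-cong : {φ ψ φ′ ψ′ : Form v} → φ ≈K ψ → φ′ ≈K ψ′ → φ ∧′ φ′ ≈K ψ ∧′ ψ′
  ∧-cong = ≈K-lift₂ (cong₂ _∧_)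

  ∨-cong : {φ ψ φ′ ψ′ : Form v} → φ ≈K ψ → φ′ ≈K ψ′ → φ ∨′ φ′ ≈K ψ ∨′ ψ′
  ∨-cong = ≈K-lift₂ (cong₂ _∨_)

  ⇒-cong : {φ ψ φ′ ψ′ : Form v} → φ ≈K ψ → φ′ ≈K ψ′ → (φ ⇒ φ′) ≈K (ψ ⇒ ψ′)
  ⇒-cong = ≈K-lift₂ (cong₂ λ a b → not a ∨ b)

  ≈K⇒⊢⇒ : {φ ψ : Form v} → φ ≈K ψ → ⊢K (φ ⇒ ψ)
  ≈K⇒⊢⇒ {φ} {ψ} = taut-mp₁ λ ρ β e →
    ⇒-true (trans (sym (⇔-true⁻ {evalB ρ β φ} {evalB ρ β ψ} e)))

  □-mono : {φ ψ : Form v} → ⊢K (φ ⇒ ψ) → ⊢K (□ φ ⇒ □ ψ)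
  □-mono = mp axK ∘ nec

  □-cong : {φ ψ : Form v} → φ ≈K ψ → □ φ ≈K □ ψ
  □-cong p = taut-mp₂ (λ _ _ → cong₂ _∧_)
    (□-mono (≈K⇒⊢⇒ p)) (□-mono (≈K⇒⊢⇒ (≈K-sym p)))

  ◇-cong : {φ ψ : Form v} → φ ≈K ψ → ◇ φ ≈K ◇ ψ
  ◇-cong = ¬-cong ∘ □-cong ∘ ¬-cong

≈K-setoid : ℕ → Setoid _ _
≈K-setoid v = record { isEquivalence = ≈K-isEquivalence {v} }

module ≈K-Reasoning {v : ℕ} = SetoidReasoning (≈K-setoid v)

module _ {v : ℕ} where

  _⟪_⟫ : (Fin v → Bool) → Subst0 v → Fin v → Bool
  (ρ ⟪ σ ⟫) i = evalP ρ (σ i)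

  evalP-cong : {ρ ρ′ : Fin v → Bool} → ρ ≗ ρ′ → ∀ a → evalP ρ a ≡ evalP ρ′ a
  evalP-cong h (pvar i) = h i
  evalP-cong h p⊥       = refl
  evalP-cong h p⊤       = refl
  evalP-cong h (p¬ a)   = cong not (evalP-cong h a)
  evalP-cong h (p∧ a b) = cong₂ _∧_ (evalP-cong h a) (evalP-cong h b)
  evalP-cong h (p∨ a b) = cong₂ _∨_ (evalP-cong h a) (evalP-cong h b)
  evalP-cong h (p⇒ a b) = cong₂ (λ x y → not x ∨ y) (evalP-cong h a) (evalP-cong h b)

  evalP-psubst : ∀ ρ (σ : Subst0 v) a → evalP ρ (psubst σ a) ≡ evalP (ρ ⟪ σ ⟫) a
  evalP-psubst ρ σ (pvar i) = refl
  evalP-psubst ρ σ p⊥       = refl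
  evalP-psubst ρ σ p⊤       = refl
  evalP-psubst ρ σ (p¬ a)   = cong not (evalP-psubst ρ σ a)
  evalP-psubst ρ σ (p∧ a b) = cong₂ _∧_ (evalP-psubst ρ σ a) (evalP-psubst ρ σ b)
  evalP-psubst ρ σ (p∨ a b) = cong₂ _∨_ (evalP-psubst ρ σ a) (evalP-psubst ρ σ b)
  evalP-psubst ρ σ (p⇒ a b) =
    cong₂ (λ x y → not x ∨ y) (evalP-psubst ρ σ a) (evalP-psubst ρ σ b)

  ⟪⟫-cong : {ρ ρ′ : Fin v → Bool} (σ : Subst0 v) → ρ ≗ ρ′ → ρ ⟪ σ ⟫ ≗ ρ′ ⟪ σ ⟫
  ⟪⟫-cong σ h i = evalP-cong h (σ i)

  ⟪⟫-inverse : {σ τ : Subst0 v} → (σ · τ) ≈S idS → ∀ ρ → (ρ ⟪ τ ⟫) ⟪ σ ⟫ ≗ ρ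
  ⟪⟫-inverse {σ} {τ} στ ρ i = trans (sym (evalP-psubst ρ τ (σ i))) (στ i ρ)

  evalB-embed : ∀ ρ β (a : PForm v) → evalB ρ β (embed a) ≡ evalP ρ a
  evalB-embed ρ β (pvar i) = refl
  evalB-embed ρ β p⊥       = refl
  evalB-embed ρ β p⊤       = refl
  evalB-embed ρ β (p¬ a)   = cong not (evalB-embed ρ β a)
  evalB-embed ρ β (p∧ a b) = cong₂ _∧_ (evalB-embed ρ β a) (evalB-embed ρ β b)
  evalB-embed ρ β (p∨ a b) = cong₂ _∨_ (evalB-embed ρ β a) (evalB-embed ρ β b)
  evalB-embed ρ β (p⇒ a b) =
    cong₂ (λ x y → not x ∨ y) (evalB-embed ρ β a) (evalB-embed ρ β b)

  evalB-∘S : ∀ ρ β (σ : Subst0 v) φ →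
             evalB ρ β (φ ∘S σ) ≡ evalB (ρ ⟪ σ ⟫) (β ∘ (_∘S σ)) φ
  evalB-∘S ρ β σ (var i)  = evalB-embed ρ β (σ i)
  evalB-∘S ρ β σ ⊥′       = refl
  evalB-∘S ρ β σ ⊤′       = refl
  evalB-∘S ρ β σ (¬′ φ)   = cong not (evalB-∘S ρ β σ φ)
  evalB-∘S ρ β σ (φ ∧′ ψ) = cong₂ _∧_ (evalB-∘S ρ β σ φ) (evalB-∘S ρ β σ ψ)
  evalB-∘S ρ β σ (φ ∨′ ψ) = cong₂ _∨_ (evalB-∘S ρ β σ φ) (evalB-∘S ρ β σ ψ)
  evalB-∘S ρ β σ (φ ⇒ ψ)  =
    cong₂ (λ x y → not x ∨ y) (evalB-∘S ρ β σ φ) (evalB-∘S ρ β σ ψ)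
  evalB-∘S ρ β σ (□ φ)    = refl

  ⊢K-∘S : ∀ {φ : Form v} (σ : Subst0 v) → ⊢K φ → ⊢K (φ ∘S σ)
  ⊢K-∘S σ (taut {φ} k) = taut λ ρ β → trans (evalB-∘S ρ β σ φ) (k _ _)
  ⊢K-∘S σ axK          = axK
  ⊢K-∘S σ (mp p q)     = mp (⊢K-∘S σ p) (⊢K-∘S σ q)
  ⊢K-∘S σ (nec p)      = nec (⊢K-∘S σ p)

  embed-∘S : ∀ (a : PForm v) τ → embed a ∘S τ ≡ embed (psubst τ a)
  embed-∘S (pvar i) τ = refl
  embed-∘S p⊥       τ = refl
  embed-∘S p⊤       τ = refl
  embed-∘S (p¬ a)   τ = cong ¬′_ (embed-∘S a τ)
  embed-∘S (p∧ a b) τ = cong₂ _∧′_ (embed-∘S a τ) (embed-∘S b τ)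
  embed-∘S (p∨ a b) τ = cong₂ _∨′_ (embed-∘S a τ) (embed-∘S b τ)
  embed-∘S (p⇒ a b) τ = cong₂ _⇒_ (embed-∘S a τ) (embed-∘S b τ)

  ∘S-· : ∀ (φ : Form v) σ τ → (φ ∘S σ) ∘S τ ≡ φ ∘S (σ · τ)
  ∘S-· (var i)  σ τ = embed-∘S (σ i) τ
  ∘S-· ⊥′       σ τ = refl
  ∘S-· ⊤′       σ τ = refl
  ∘S-· (¬′ φ)   σ τ = cong ¬′_ (∘S-· φ σ τ)
  ∘S-· (φ ∧′ ψ) σ τ = cong₂ _∧′_ (∘S-· φ σ τ) (∘S-· ψ σ τ)
  ∘S-· (φ ∨′ ψ) σ τ = cong₂ _∨′_ (∘S-· φ σ τ) (∘S-· ψ σ τ)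
  ∘S-· (φ ⇒ ψ)  σ τ = cong₂ _⇒_ (∘S-· φ σ τ) (∘S-· ψ σ τ)
  ∘S-· (□ φ)    σ τ = cong □_ (∘S-· φ σ τ)

  ∘S-idS : ∀ (φ : Form v) → φ ∘S idS ≡ φ
  ∘S-idS (var i)  = refl
  ∘S-idS ⊥′       = refl
  ∘S-idS ⊤′       = refl
  ∘S-idS (¬′ φ)   = cong ¬′_ (∘S-idS φ)
  ∘S-idS (φ ∧′ ψ) = cong₂ _∧′_ (∘S-idS φ) (∘S-idS ψ)
  ∘S-idS (φ ∨′ ψ) = cong₂ _∨′_ (∘S-idS φ) (∘S-idS ψ)
  ∘S-idS (φ ⇒ ψ)  = cong₂ _⇒_ (∘S-idS φ) (∘S-idS ψ)
  ∘S-idS (□ φ)    = cong □_ (∘S-idS φ)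

  ∘S-cong : ∀ (φ : Form v) {σ σ′} → σ ≈S σ′ → φ ∘S σ ≈K φ ∘S σ′
  ∘S-cong (var i) {σ} {σ′} h = ≈K-taut λ ρ β →
    trans (evalB-embed ρ β (σ i)) (trans (h i ρ) (sym (evalB-embed ρ β (σ′ i))))
  ∘S-cong ⊥′       h = ≈K-refl
  ∘S-cong ⊤′       h = ≈K-refl
  ∘S-cong (¬′ φ)   h = ¬-cong (∘S-cong φ h)
  ∘S-cong (φ ∧′ ψ) h = ∧-cong (∘S-cong φ h) (∘S-cong ψ h)
  ∘S-cong (φ ∨′ ψ) h = ∨-cong (∘S-cong φ h) (∘S-cong ψ h)
  ∘S-cong (φ ⇒ ψ)  h = ⇒-cong (∘S-cong φ h) (∘S-cong ψ h)
  ∘S-cong (□ φ)    h = □-cong (∘S-cong φ h)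

  ∘S-inverse : ∀ {σ τ : Subst0 v} → (σ · τ) ≈S idS → ∀ φ → (φ ∘S σ) ∘S τ ≈K φ
  ∘S-inverse {σ} {τ} στ φ = begin
    (φ ∘S σ) ∘S τ  ≡⟨ ∘S-· φ σ τ ⟩
    φ ∘S (σ · τ)   ≈⟨ ∘S-cong φ στ ⟩
    φ ∘S idS       ≡⟨ ∘S-idS φ ⟩
    φ              ∎
    where open ≈K-Reasoning

  ∘S-cancel : ∀ {σ τ : Subst0 v} → (σ · τ) ≈S idS →
              ∀ {φ ψ} → φ ∘S σ ≈K ψ ∘S σ → φ ≈K ψ
  ∘S-cancel {σ} {τ} στ {φ} {ψ} h = begin
    φ              ≈⟨ ∘S-inverse στ φ ⟨
    (φ ∘S σ) ∘S τ  ≈⟨ ⊢K-∘S τ h ⟩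
    (ψ ∘S σ) ∘S τ  ≈⟨ ∘S-inverse στ ψ ⟩
    ψ              ∎
    where open ≈K-Reasoning

substK-isLatticeAutomorphism : ∀ {v d} {σ : Subst0 v} → IsPrime σ →
                               IsLatticeAutomorphism {v} {d} (substK σ)
substK-isLatticeAutomorphism {σ = σ} (τ , στ , τσ) = record
  { isLatticeMonomorphism = record
    { isLatticeHomomorphism = record
      { isRelHomomorphism = record { cong = ⊢K-∘S σ }
      ; ∧-homo = λ _ _ → ≈K-refl
      ; ∨-homo = λ _ _ → ≈K-refl
      }
    ; injective = ∘S-cancel στ
    }
  ; surjective = λ y → substK τ y , λ z≈ → ≈K-trans (⊢K-∘S σ z≈) (∘S-inverse τσ (proj₁ y))
  }

Elem : {A : Set} → List A → Set
Elem {A} L = Σ A (_∈ L)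

module _ {A : Set} where

  Elem-≡ : {L : List A} → Unique L → {x y : A} → x ≡ y →
           {p : x ∈ L} {q : y ∈ L} → (x , p) ≡ (y , q)
  Elem-≡ L! {x} refl = cong (x ,_) (unique⇒irrelevant L! _ _)

  Elem-cast : {L L′ : List A} → L ≡ L′ → Elem L ↔ Elem L′
  Elem-cast L≡L′ = mk↔ₛ′
    (map₂ (subst (_ ∈_) L≡L′)) (map₂ (subst (_ ∈_) (sym L≡L′)))
    (λ (x , p) → cong (x ,_) (subst-subst-sym L≡L′))
    (λ (x , p) → cong (x ,_) (subst-sym-subst L≡L′))

module _ {A B C : Set} (f : A → B → C) where

  concatMap-map : ∀ xs ys → concatMap (λ x → map (f x) ys) xs ≡ cartesianProductWith f xs ys
  concatMap-map []       ys = refl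
  concatMap-map (x ∷ xs) ys = cong (map (f x) ys ++_) (concatMap-map xs ys)

  module _ (f-injective : ∀ {a a′ b b′} → f a b ≡ f a′ b′ → a ≡ a′ × b ≡ b′)
           {xs : List A} {ys : List B} (xs! : Unique xs) (ys! : Unique ys) where

    Elem-cartesianProductWith : Elem (cartesianProductWith f xs ys) ↔ (Elem xs × Elem ys)
    Elem-cartesianProductWith = mk↔ₛ′ (split ∘ ∈⁻ ∘ proj₂) join split-join join-split
      where
      ∈⁻ = ∈-cartesianProductWith⁻ f xs ys

      split : ∀ {z} → (∃ λ a → ∃ λ b → a ∈ xs × b ∈ ys × z ≡ f a b) → Elem xs × Elem ys
      split (a , b , a∈ , b∈ , _) = (a , a∈) , (b , b∈)

      join : Elem xs × Elem ys → Elem (cartesianProductWith f xs ys)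
      join ((a , a∈) , (b , b∈)) = f a b , ∈-cartesianProductWith⁺ f a∈ b∈

      split-join : ∀ ab → split (∈⁻ (proj₂ (join ab))) ≡ ab
      split-join ((a , a∈) , (b , b∈)) with ∈⁻ (∈-cartesianProductWith⁺ f a∈ b∈)
      ... | _ , _ , _ , _ , eq with f-injective eq
      ...   | a≡ , b≡ = cong₂ _,_ (Elem-≡ xs! (sym a≡)) (Elem-≡ ys! (sym b≡))

      join-split : ∀ z → join (split (∈⁻ (proj₂ z))) ≡ z
      join-split (z , z∈) with ∈⁻ z∈
      ... | _ , _ , _ , _ , eq =
        Elem-≡ (cartesianProductWith⁺ f f-injective xs! ys!) (sym eq)

Realises : ∀ {v} → Subst0 v → (L : List (Form v)) → Elem L ↔ Elem L → Set
Realises σ L π = ∀ μ → proj₁ μ ∘S σ ≈K proj₁ (Inverse.to π μ)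

-- Signs are indexed by positions (membership proofs) rather than by elements; on the
-- duplicate-free lists used below the two agree, by unique⇒irrelevant.
Signs : {A : Set} → List A → Set
Signs L = Elem L → Bool

_◂_ : {A : Set} {a : A} {L : List A} → Bool → Signs L → Signs (a ∷ L)
(b ◂ s) (_ , here _)  = b
(b ◂ s) (x , there p) = s (x , p)

lit : ∀ {v} → Bool → Form v → Form v
lit true  φ = φ
lit false φ = ¬′ φ

module _ {v : ℕ} where

  ∧′-injective : ∀ {φ φ′ ψ ψ′ : Form v} → φ ∧′ ψ ≡ φ′ ∧′ ψ′ → φ ≡ φ′ × ψ ≡ ψ′
  ∧′-injective refl = refl , refl

  lit-injective : ∀ {φ : Form v} → φ ≢ ¬′ φ → ∀ {b b′} → lit b φ ≡ lit b′ φ → b ≡ b′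
  lit-injective φ≢¬φ {true}  {true}  _ = refl
  lit-injective φ≢¬φ {true}  {false} e = ⊥-elim (φ≢¬φ e)
  lit-injective φ≢¬φ {false} {true}  e = ⊥-elim (φ≢¬φ (sym e))
  lit-injective φ≢¬φ {false} {false} _ = refl

  lit-∘S : ∀ b (φ : Form v) σ → lit b φ ∘S σ ≡ lit b (φ ∘S σ)
  lit-∘S true  φ σ = refl
  lit-∘S false φ σ = refl

  lit-cong : ∀ b {φ ψ : Form v} → φ ≈K ψ → lit b φ ≈K lit b ψ
  lit-cong true  = id
  lit-cong false = ¬-cong

  evalB-lit⁺ : ∀ {ρ β} b (φ : Form v) → evalB ρ β φ ≡ b → evalB ρ β (lit b φ) ≡ true
  evalB-lit⁺ true  φ e = e
  evalB-lit⁺ false φ e = cong not e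

  evalB-lit⁻ : ∀ {ρ β} b (φ : Form v) → evalB ρ β (lit b φ) ≡ true → evalB ρ β φ ≡ b
  evalB-lit⁻ true  φ e = e
  evalB-lit⁻ false φ e = not-injective e

module _ {v : ℕ} {A : Set} where

  conj : (L : List A) → (Elem L → Form v) → Signs L → Form v
  conj []      G s = ⊤′
  conj (a ∷ L) G s =
    lit (s (a , here refl)) (G (a , here refl)) ∧′ conj L (G ∘ map₂ there) (s ∘ map₂ there)

  evalB-conj⁺ : ∀ {ρ β} L G s → (∀ e → evalB ρ β (G e) ≡ s e) → evalB ρ β (conj L G s) ≡ true
  evalB-conj⁺ []      G s h = refl
  evalB-conj⁺ (a ∷ L) G s h =
    cong₂ _∧_ (evalB-lit⁺ _ _ (h (a , here refl))) (evalB-conj⁺ L _ _ (h ∘ map₂ there))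

  evalB-conj⁻ : ∀ {ρ β} L G s → evalB ρ β (conj L G s) ≡ true → ∀ e → evalB ρ β (G e) ≡ s e
  evalB-conj⁻ (a ∷ L) G s h (_ , here refl) = evalB-lit⁻ _ _ (∧-conicalˡ _ _ h)
  evalB-conj⁻ (a ∷ L) G s h (x , there p)   = evalB-conj⁻ L _ _ (∧-conicalʳ _ _ h) (x , p)

  conj-∘S : ∀ L G s (σ : Subst0 v) → conj L G s ∘S σ ≡ conj L ((_∘S σ) ∘ G) s
  conj-∘S []      G s σ = refl
  conj-∘S (a ∷ L) G s σ =
    cong₂ _∧′_ (lit-∘S (s (a , here refl)) (G (a , here refl)) σ) (conj-∘S L _ _ σ)

  conj-cong : ∀ L {G G′} s → (∀ e → G e ≈K G′ e) → conj L G s ≈K conj L G′ s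
  conj-cong []      s h = ≈K-refl
  conj-cong (a ∷ L) s h = ∧-cong (lit-cong _ (h (a , here refl))) (conj-cong L _ (h ∘ map₂ there))

  conj-cong-signs : ∀ L G {s s′} → s ≗ s′ → conj L G s ≡ conj L G s′
  conj-cong-signs []      G h = refl
  conj-cong-signs (a ∷ L) G h =
    cong₂ (λ b c → lit b _ ∧′ c) (h (a , here refl)) (conj-cong-signs L _ (h ∘ map₂ there))

  conj-injective : ∀ L G → (∀ e → G e ≢ ¬′ G e) →
                   ∀ {s s′} → conj L G s ≡ conj L G s′ → s ≗ s′
  conj-injective (a ∷ L) G G≢¬G eq (_ , here refl) =
    lit-injective (G≢¬G _) (proj₁ (∧′-injective eq))
  conj-injective (a ∷ L) G G≢¬G eq (x , there p)   =
    conj-injective L _ (G≢¬G ∘ map₂ there) (proj₂ (∧′-injective eq)) (x , p)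

  conj-reindex : ∀ {L L′ : List A} (π : Elem L ↔ Elem L′) G s →
                 conj L (G ∘ Inverse.to π) s ≈K conj L′ G (s ∘ Inverse.from π)
  conj-reindex {L} {L′} π G s = ≈K-taut λ ρ β → ⇔→≡ (mk⇔
    (λ h → evalB-conj⁺ L′ G _ λ e → subst (λ e′ → evalB ρ β (G e′) ≡ _)
      (strictlyInverseˡ e) (evalB-conj⁻ L _ s h (from e)))
    (λ h → evalB-conj⁺ L _ s λ e →
      trans (evalB-conj⁻ L′ G _ h (to e)) (cong s (strictlyInverseʳ e))))
    where open Inverse π

  module _ (g : A → Form v) where

    conj∈signs : ∀ L s → conj L (g ∘ proj₁) s ∈ signs (map g L)
    conj∈signs []      s = here refl
    conj∈signs (a ∷ L) s =
      ∈-concatMap⁺ _ {xs = signs (map g L)} (lose (conj∈signs L _) (lit∈ (s (a , here refl))))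
      where
      lit∈ : ∀ {c} b → lit b (g a) ∧′ c ∈ (g a ∧′ c) ∷ (¬′ g a ∧′ c) ∷ []
      lit∈ true  = here refl
      lit∈ false = there (here refl)

    ∈signs⇒conj : ∀ L {c} → c ∈ signs (map g L) → ∃ λ s → c ≡ conj L (g ∘ proj₁) s
    ∈signs⇒conj []      (here refl) = (λ _ → true) , refl
    ∈signs⇒conj (a ∷ L) c∈ with find (∈-concatMap⁻ _ {xs = signs (map g L)} c∈)
    ... | c′ , c′∈ , c∈pair with ∈signs⇒conj L c′∈
    ...   | s , refl with c∈pair
    ...     | here refl         = true ◂ s , refl
    ...     | there (here refl) = false ◂ s , refl

    module _ (g≢¬g : ∀ a → g a ≢ ¬′ g a) where

      -- signs (map g (a ∷ L)) is the product of signs (map g L) with the two polarities of g a.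
      signs-unique : ∀ L → Unique (signs (map g L))
      signs-unique []      = [] ∷ []
      signs-unique (a ∷ L) =
        subst Unique (sym (concatMap-map f (signs (map g L)) (true ∷ false ∷ [])))
          (cartesianProductWith⁺ f f-injective (signs-unique L) (((λ ()) ∷ []) ∷ [] ∷ []))
        where
        f : Form v → Bool → Form v
        f c b = lit b (g a) ∧′ c

        f-injective : ∀ {c c′ b b′} → f c b ≡ f c′ b′ → c ≡ c′ × b ≡ b′
        f-injective eq with ∧′-injective eq
        ... | lit≡ , c≡ = c≡ , lit-injective (g≢¬g a) lit≡

      module _ (L : List A) where

        code : Elem (signs (map g L)) → Signs L
        code = proj₁ ∘ ∈signs⇒conj L ∘ proj₂

        decode : Signs L → Elem (signs (map g L))
        decode s = conj L (g ∘ proj₁) s , conj∈signs L s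

        decode-cong : ∀ {s s′} → s ≗ s′ → decode s ≡ decode s′
        decode-cong s≗s′ = Elem-≡ (signs-unique L) (conj-cong-signs L _ s≗s′)

        decode-code : ∀ c → decode (code c) ≡ c
        decode-code (c , c∈) = Elem-≡ (signs-unique L) (sym (proj₂ (∈signs⇒conj L c∈)))

        code-decode : ∀ s → code (decode s) ≗ s
        code-decode s =
          conj-injective L _ (g≢¬g ∘ proj₁) (sym (proj₂ (∈signs⇒conj L (conj∈signs L s))))

        module SignPermutation (T U : Signs L → Signs L)
                               (T-cong : ∀ {s s′} → s ≗ s′ → T s ≗ T s′)
                               (U-cong : ∀ {s s′} → s ≗ s′ → U s ≗ U s′)
                               (TU : ∀ s → T (U s) ≗ s) (UT : ∀ s → U (T s) ≗ s) where

          permutation : Elem (signs (map g L)) ↔ Elem (signs (map g L))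
          permutation = mk↔ₛ′ (decode ∘ T ∘ code) (decode ∘ U ∘ code)
            (round-trip T U T-cong TU) (round-trip U T U-cong UT)
            where
            round-trip : ∀ F F⁻¹ → (∀ {s s′} → s ≗ s′ → F s ≗ F s′) → (∀ s → F (F⁻¹ s) ≗ s) →
                         ∀ c → decode (F (code (decode (F⁻¹ (code c))))) ≡ c
            round-trip F F⁻¹ F-cong FF⁻¹ c = trans
              (decode-cong λ e → trans (F-cong (code-decode _) e) (FF⁻¹ (code c) e))
              (decode-code c)

          permutation-realises : ∀ {σ} →
                                 (∀ s → conj L (g ∘ proj₁) s ∘S σ ≈K conj L (g ∘ proj₁) (T s)) →
                                 Realises σ (signs (map g L)) permutation
          permutation-realises {σ} realise (c , c∈) =
            subst (λ c′ → c′ ∘S σ ≈K conj L (g ∘ proj₁) (T (code (c , c∈))))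
              (sym (proj₂ (∈signs⇒conj L c∈))) (realise _)

module _ {v : ℕ} where

  var≢¬var : ∀ (i : Fin v) → var i ≢ ¬′ var i
  var≢¬var i ()

  ◇≢¬◇ : ∀ (φ : Form v) → ◇ φ ≢ ¬′ ◇ φ
  ◇≢¬◇ φ ()

  minterms-suc : ∀ d → minterms v (suc d) ≡
                       cartesianProductWith _∧′_ (minterms v 0) (signs (map ◇_ (minterms v d)))
  minterms-suc d = concatMap-map _∧′_ (minterms v 0) (signs (map ◇_ (minterms v d)))

  minterms-unique : ∀ d → Unique (minterms v d)
  minterms-unique zero    = signs-unique var var≢¬var (allFin v)
  minterms-unique (suc d) = subst Unique (sym (minterms-suc d))
    (cartesianProductWith⁺ _∧′_ ∧′-injective
      (minterms-unique 0) (signs-unique ◇_ ◇≢¬◇ (minterms v d)))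

  Minterm-suc↔ : ∀ d → Minterm v (suc d) ↔ (Minterm v 0 × Elem (signs (map ◇_ (minterms v d))))
  Minterm-suc↔ d =
    Elem-cartesianProductWith _∧′_ ∧′-injective
      (minterms-unique 0) (signs-unique ◇_ ◇≢¬◇ (minterms v d))
      ↔-∘ Elem-cast (minterms-suc d)

  valuation : Signs (allFin v) → Fin v → Bool
  valuation s i = s (i , ∈-allFin i)

  signs-valuation : ∀ s e → s e ≡ valuation s (proj₁ e)
  signs-valuation s e = cong s (Elem-≡ (allFin⁺ v) refl)

  pullback : Subst0 v → Signs (allFin v) → Signs (allFin v)
  pullback σ s = valuation s ⟪ σ ⟫ ∘ proj₁

  pullback-cong : ∀ σ {s s′} → s ≗ s′ → pullback σ s ≗ pullback σ s′
  pullback-cong σ s≗s′ = ⟪⟫-cong σ (s≗s′ ∘ (_, ∈-allFin _)) ∘ proj₁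

  pullback-inverse : ∀ {σ τ : Subst0 v} → (σ · τ) ≈S idS → ∀ s → pullback σ (pullback τ s) ≗ s
  pullback-inverse {σ} {τ} στ s e =
    trans (⟪⟫-inverse {σ = σ} {τ} στ (valuation s) (proj₁ e)) (sym (signs-valuation s e))

  ⟪⟫-transpose : ∀ {σ τ : Subst0 v} → (τ · σ) ≈S idS →
                 ∀ {ρ r} → ρ ⟪ σ ⟫ ≗ r → ρ ≗ r ⟪ τ ⟫
  ⟪⟫-transpose {σ} {τ} τσ {ρ} h i = trans (sym (⟪⟫-inverse {σ = τ} {σ} τσ ρ i)) (⟪⟫-cong τ h i)

module _ {v : ℕ} {σ τ : Subst0 v} (στ : (σ · τ) ≈S idS) (τσ : (τ · σ) ≈S idS) where

  module Pullback = SignPermutation var var≢¬var (allFin v) (pullback τ) (pullback σ)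
    (pullback-cong τ) (pullback-cong σ)
    (pullback-inverse {σ = τ} {σ} τσ) (pullback-inverse {σ = σ} {τ} στ)

  realises₀ : ∀ s → conj (allFin v) (var ∘ proj₁) s ∘S σ ≈K
                    conj (allFin v) (var ∘ proj₁) (pullback τ s)
  realises₀ s = ≈K-trans (≈K-reflexive (conj-∘S (allFin v) (var ∘ proj₁) s σ))
    (≈K-taut λ ρ β → ⇔→≡ (mk⇔ (σ-side ρ β) (τ-side ρ β)))
    where
    σ-side : ∀ ρ β → evalB ρ β (conj (allFin v) (embed ∘ σ ∘ proj₁) s) ≡ true →
             evalB ρ β (conj (allFin v) (var ∘ proj₁) (pullback τ s)) ≡ true
    σ-side ρ β h = evalB-conj⁺ (allFin v) _ _ λ e → ⟪⟫-transpose {σ = σ} {τ} τσ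
      (λ i → trans (sym (evalB-embed ρ β (σ i))) (evalB-conj⁻ (allFin v) _ s h (i , ∈-allFin i)))
      (proj₁ e)

    τ-side : ∀ ρ β → evalB ρ β (conj (allFin v) (var ∘ proj₁) (pullback τ s)) ≡ true →
             evalB ρ β (conj (allFin v) (embed ∘ σ ∘ proj₁) s) ≡ true
    τ-side ρ β h = evalB-conj⁺ (allFin v) _ s λ e → trans (evalB-embed ρ β (σ (proj₁ e)))
      (trans (sym (⟪⟫-transpose {σ = τ} {σ} στ
                     (λ i → sym (evalB-conj⁻ (allFin v) _ _ h (i , ∈-allFin i))) (proj₁ e)))
             (sym (signs-valuation s e)))

  mintermPermutation : ∀ d → Σ (Minterm v d ↔ Minterm v d) (Realises σ (minterms v d))
  mintermPermutation zero    = Pullback.permutation , Pullback.permutation-realises realises₀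
  mintermPermutation (suc d) = π₊ , realises
    where
    M  = Minterm-suc↔ d
    π₀ = proj₁ (mintermPermutation 0)
    π  = proj₁ (mintermPermutation d)
    open Inverse π using (to; from; strictlyInverseˡ; strictlyInverseʳ)

    module Reindex = SignPermutation ◇_ ◇≢¬◇ (minterms v d) (_∘ from) (_∘ to)
      (_∘ from) (_∘ to) (λ s → cong s ∘ strictlyInverseˡ) (λ s → cong s ∘ strictlyInverseʳ)

    π₊ : Minterm v (suc d) ↔ Minterm v (suc d)
    π₊ = ↔-sym M ↔-∘ ((π₀ ×-↔ Reindex.permutation) ↔-∘ M)

    realises-signs : ∀ s → conj (minterms v d) (◇_ ∘ proj₁) s ∘S σ ≈K
                           conj (minterms v d) (◇_ ∘ proj₁) (s ∘ from)
    realises-signs s = begin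
      conj (minterms v d) (◇_ ∘ proj₁) s ∘S σ         ≡⟨ conj-∘S (minterms v d) (◇_ ∘ proj₁) s σ ⟩
      conj (minterms v d) (λ μ → ◇ (proj₁ μ ∘S σ)) s  ≈⟨ conj-cong (minterms v d) s
                                                            (◇-cong ∘ proj₂ (mintermPermutation d)) ⟩
      conj (minterms v d) (◇_ ∘ proj₁ ∘ to) s         ≈⟨ conj-reindex π (◇_ ∘ proj₁) s ⟩
      conj (minterms v d) (◇_ ∘ proj₁) (s ∘ from)     ∎
      where open ≈K-Reasoning

    realises : Realises σ (minterms v (suc d)) π₊
    realises μ = begin
      proj₁ μ ∘S σ                      ≡⟨ cong (_∘S σ ∘ proj₁) (Inverse.strictlyInverseʳ M μ) ⟨
      (proj₁ m ∘S σ) ∧′ (proj₁ c ∘S σ)  ≈⟨ ∧-cong (proj₂ (mintermPermutation 0) m)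
                                                  (Reindex.permutation-realises realises-signs c) ⟩
      proj₁ (Inverse.to π₊ μ)           ∎
      where
      open ≈K-Reasoning
      m = proj₁ (Inverse.to M μ)
      c = proj₂ (Inverse.to M μ)

Realises⇒Bijective : ∀ {v d} {σ τ : Subst0 v} → (σ · τ) ≈S idS →
                     (π : Minterm v d ↔ Minterm v d) → Realises σ (minterms v d) π →
                     Bijective (_≈M_ {v} {d}) (_≈M_ {v} {d}) (Inverse.to π)
Realises⇒Bijective {σ = σ} στ π realises = injective , surjective
  where
  open Inverse π using (to; from; strictlyInverseˡ)
  injective : ∀ {μ ν} → proj₁ (to μ) ≈K proj₁ (to ν) → proj₁ μ ≈K proj₁ ν
  injective {μ} {ν} h = ∘S-cancel στ (≈K-trans (realises μ) (≈K-trans h (≈K-sym (realises ν))))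
  surjective : ∀ ν → ∃ λ μ → ∀ {κ} → proj₁ κ ≈K proj₁ μ → proj₁ (to κ) ≈K proj₁ ν
  surjective ν = from ν , λ {κ} h → begin
    proj₁ (to κ)              ≈⟨ realises κ ⟨
    proj₁ κ ∘S σ              ≈⟨ ⊢K-∘S σ h ⟩
    proj₁ (from ν) ∘S σ       ≈⟨ realises (from ν) ⟩
    proj₁ (to (from ν))       ≡⟨ cong proj₁ (strictlyInverseˡ ν) ⟩
    proj₁ ν                   ∎
    where open ≈K-Reasoning

theorem4 : (v : ℕ) (ς : Subst0 v) → IsPrime ς → (d : ℕ) →
    Σ (Minterm v d → Minterm v d)
      (λ f → (∀ μ → proj₁ (f μ) ≈K (proj₁ μ ∘S ς)) × Bijective (_≈M_ {v} {d}) (_≈M_ {v} {d}) f)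
    × IsLatticeAutomorphism {v} {d} (substK ς)
theorem4 v ς ς-prime@(τ , ςτ , τς) d =
  (Inverse.to π , ≈K-sym ∘ π-realises , Realises⇒Bijective {d = d} ςτ π π-realises) ,
  substK-isLatticeAutomorphism ς-prime
  where
  π = proj₁ (mintermPermutation ςτ τς d)
  π-realises = proj₂ (mintermPermutation ςτ τς d)
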